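{- Let $m,s \geq 1$ be integers with $s < m/2$. If $A,B \subseteq \mathbb{Z}_m$ are non-empty and cross-$s$-agreeing then $|A| + |B| \leq 2s$. Moreover, if $|A| + |B| = 2s$ then $A,B$ are intervals centered at the same point or half-point. In particular, if $A$ is $s$-agreeing then $|A| \leq s$, with equality only when $A$ is an interval. When $s = m/2$ it still holds that $|A| + |B| \leq 2s$ for cross-$s$-agreeing $A,B\subseteq\mathbb{Z}_m$ (even without assuming $A,B$ non-empty), with equality precisely when $B = \{ x : x + s \notin A \}$. In particular, if $A$ is $s$-agreeing then $|A| \leq s$, with equality only when $A$ contains exactly one point out of each pair $\{x,x+s\}$.
   Context: A set $A \subseteq \mathbb{Z}_m$ is $s$-agreeing if every $a,b \in A$ satisfy $a-b \in \{ -(s-1),\ldots,s-1\}$ (in $\mathbb{Z}_m$). Two sets $A,B \subseteq \mathbb{Z}_m$ are cross-$s$-agreeing if every $a \in A$, $b \in B$ satisfy $a-b \in \{ -(s-1),\ldots,s-1\}$. A set $A\subseteq\mathbb{Z}_m$ is an interval if it is of the form $\{x-\ell,\ldots,x+\ell\}$ with $2\ell+1 < m$ (its center is $x$) or $\{x-\ell,\ldots,x+\ell-1\}$ with $2\ell < m$ (its center is the half-point $x-1/2$). -}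

module Defs where

open import Data.Nat using (ℕ; _+_; _*_; _∸_; _<_; _≤_; NonZero)
open import Data.Nat.DivMod using (_%_; m%n<n)
open import Data.Fin using (Fin; toℕ; fromℕ<)
open import Data.Fin.Subset using (Subset; _∈_; _∉_)
open import Data.Product using (Σ; ∃; _×_)
open import Data.Sum using (_⊎_)
open import Function.Bundles using (_⇔_)
open import Relation.Binary.PropositionalEquality using (_≡_)

diffMod : (m : ℕ) .{{_ : NonZero m}} → Fin m → Fin m → ℕ
diffMod m a b = (toℕ a + (m ∸ toℕ b)) % m

-- d ∈ {0..m-1} represents an element of {-(s-1),...,s-1} (mod m)
-- iff d ≤ s-1 (i.e. d < s) or d ≥ m-(s-1) (i.e. m < d + s)
InAgreeRange : (m s d : ℕ) → Set
InAgreeRange m s d = (d < s) ⊎ (m < d + s)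

CrossAgreeing : (m : ℕ) .{{_ : NonZero m}} → ℕ → Subset m → Subset m → Set
CrossAgreeing m s A B =
  ∀ a b → a ∈ A → b ∈ B → InAgreeRange m s (diffMod m a b)

Agreeing : (m : ℕ) .{{_ : NonZero m}} → ℕ → Subset m → Set
Agreeing m s A = CrossAgreeing m s A A

addMod : (m : ℕ) .{{_ : NonZero m}} → Fin m → ℕ → Fin m
addMod m x k = fromℕ< (m%n<n (toℕ x + k) m)

-- A = { x-ℓ, x-ℓ+1, ..., x-ℓ+(len-1) } in Z_m   (requires ℓ < m for m∸ℓ to mean -ℓ)
RunFrom : (m : ℕ) .{{_ : NonZero m}} → Fin m → ℕ → ℕ → Subset m → Set
RunFrom m x ℓ len A =
  ∀ y → (y ∈ A) ⇔ (∃ λ j → (j < len) × (toℕ y ≡ (toℕ x + (m ∸ ℓ) + j) % m))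

-- A = {x-ℓ,...,x+ℓ} with 2ℓ+1 < m  (interval centred at the point x)
OddIntervalAt : (m : ℕ) .{{_ : NonZero m}} → Fin m → Subset m → Set
OddIntervalAt m x A = ∃ λ ℓ → (2 * ℓ + 1 < m) × RunFrom m x ℓ (2 * ℓ + 1) A

-- A = {x-ℓ,...,x+ℓ-1} with 2ℓ < m  (interval centred at the half-point x - 1/2)
EvenIntervalAt : (m : ℕ) .{{_ : NonZero m}} → Fin m → Subset m → Set
EvenIntervalAt m x A = ∃ λ ℓ → (2 * ℓ < m) × RunFrom m x ℓ (2 * ℓ) A

IsInterval : (m : ℕ) .{{_ : NonZero m}} → Subset m → Set
IsInterval m A = ∃ λ x → OddIntervalAt m x A ⊎ EvenIntervalAt m x A

SameCenterIntervals : (m : ℕ) .{{_ : NonZero m}} → Subset m → Subset m → Set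
SameCenterIntervals m A B =
  ∃ λ x → (OddIntervalAt m x A × OddIntervalAt m x B)
        ⊎ (EvenIntervalAt m x A × EvenIntervalAt m x B)

module Submission where

-- The proof is a Cauchy–Davenport style sumset argument. Write m = 2s + k. Cross-agreement
-- says that B avoids far = A + {s, …, s + k}. Each step X ↦ X + {0, 1} of the sumset
-- A + {0, …, k} gains a point unless it is all of ℤ_m, so |far| ≥ |A| + k, and |B| + |far| ≤ m
-- gives |A| + |B| ≤ 2s. In the case of equality every step is tight: A + {0, 1} has only
-- |A| + 1 points, which forces A to be an arc; then far is an arc, B is the complementary arc,
-- and the two arcs have a common centre. For 2s = m (k = 0), B avoids A + s, and the bound is
-- attained exactly when B is the complement of A + s.

open import Defs
open import Data.Bool using (Bool; true; false; _∨_; not)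
open import Data.Bool.Properties using (∨-identityʳ; ∨-zeroʳ; ∨-inverseˡ)
open import Data.Fin using (Fin; toℕ; fromℕ<)
open import Data.Fin.Properties using (fromℕ<-cong; fromℕ<-toℕ; toℕ-fromℕ<; toℕ<n)
open import Data.Fin.Subset using (Subset; _∈_; _∉_; ∣_∣; Nonempty)
open import Data.Fin.Subset.Properties using (nonempty?; Empty-unique; ∣⊥∣≡0)
open import Data.Nat
open import Data.Nat.DivMod
open import Data.Nat.Properties
open import Data.Nat.Tactic.RingSolver using (solve-∀)
open import Data.Product using (∃; ∃₂; _×_; _,_; proj₁; proj₂)
open import Data.Sum using (inj₁; inj₂)
open import Data.Vec using (Vec; []; _∷_; lookup)
open import Data.Vec.Properties using ([]=⇒lookup; lookup⇒[]=)
open import Function.Bundles using (_⇔_; mk⇔; Equivalence)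
open import Relation.Nullary using (¬_; yes; no; contradiction)
open import Relation.Binary.PropositionalEquality

⟦_⟧ : Bool → ℕ
⟦ true ⟧  = 1
⟦ false ⟧ = 0

count : ℕ → (ℕ → Bool) → ℕ
count zero    f = 0
count (suc n) f = ⟦ f 0 ⟧ + count n (λ i → f (suc i))

_⊆[_]_ : (ℕ → Bool) → ℕ → (ℕ → Bool) → Set
f ⊆[ n ] g = ∀ i → i < n → f i ≡ true → g i ≡ true

false-antitone : ∀ {b c} → (b ≡ true → c ≡ true) → c ≡ false → b ≡ false
false-antitone {false} _ _ = refl
false-antitone {true}  h c≡false with () ← trans (sym (h refl)) c≡false

⟦⟧-mono : ∀ {b c} → (b ≡ true → c ≡ true) → ⟦ b ⟧ ≤ ⟦ c ⟧
⟦⟧-mono {false} _ = z≤n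
⟦⟧-mono {true}  h rewrite h refl = ≤-refl

count-cong : ∀ n {f g} → (∀ i → i < n → f i ≡ g i) → count n f ≡ count n g
count-cong zero    _  = refl
count-cong (suc n) eq =
  cong₂ _+_ (cong ⟦_⟧ (eq 0 z<s)) (count-cong n (λ i i<n → eq (suc i) (s<s i<n)))

count-snoc : ∀ n f → count (suc n) f ≡ count n f + ⟦ f n ⟧
count-snoc zero    f = +-comm ⟦ f 0 ⟧ 0
count-snoc (suc n) f =
  trans (cong (⟦ f 0 ⟧ +_) (count-snoc n (λ i → f (suc i)))) (sym (+-assoc ⟦ f 0 ⟧ _ _))

count-≤ : ∀ n f → count n f ≤ n
count-≤ zero    f = z≤n
count-≤ (suc n) f with f 0
... | true  = s≤s (count-≤ n _)
... | false = m≤n⇒m≤1+n (count-≤ n _)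

count-all : ∀ n {f} → (∀ i → i < n → f i ≡ true) → count n f ≡ n
count-all zero    _   = refl
count-all (suc n) all rewrite all 0 z<s = cong suc (count-all n (λ i i<n → all (suc i) (s<s i<n)))

count-none : ∀ n {f} → (∀ i → i < n → f i ≡ false) → count n f ≡ 0
count-none zero    _    = refl
count-none (suc n) none rewrite none 0 z<s = count-none n (λ i i<n → none (suc i) (s<s i<n))

count-full : ∀ n f → count n f ≡ n → ∀ i → i < n → f i ≡ true
count-full (suc n) f full i i<n with f 0 in f0 | full
... | false | full′ = contradiction full′ (<⇒≢ (s≤s (count-≤ n _)))
... | true  | full′ with i
...   | zero   = f0
...   | suc i′ = count-full n _ (suc-injective full′) i′ (s<s⁻¹ i<n)

count-member : ∀ n {f} i → i < n → f i ≡ true → 1 ≤ count n f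
count-member (suc n) {f} zero    _   fi rewrite fi = s≤s z≤n
count-member (suc n) {f} (suc i) i<n fi =
  ≤-trans (count-member n i (s<s⁻¹ i<n) fi) (m≤n+m _ ⟦ f 0 ⟧)

count-mono : ∀ n {f g} → f ⊆[ n ] g → count n f ≤ count n g
count-mono zero    _   = z≤n
count-mono (suc n) f⊆g =
  +-mono-≤ (⟦⟧-mono (f⊆g 0 z<s)) (count-mono n (λ i i<n → f⊆g (suc i) (s<s i<n)))

count-mono-< : ∀ n {f g} → f ⊆[ n ] g → ∀ i → i < n → f i ≡ false → g i ≡ true →
               count n f < count n g
count-mono-< (suc n) f⊆g zero    _   f0 g0 rewrite f0 | g0 =
  s≤s (count-mono n (λ i i<n → f⊆g (suc i) (s<s i<n)))
count-mono-< (suc n) f⊆g (suc i) i<n fi gi =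
  +-mono-≤-< (⟦⟧-mono (f⊆g 0 z<s))
             (count-mono-< n (λ j j<n → f⊆g (suc j) (s<s j<n)) i (s<s⁻¹ i<n) fi gi)

count-disjoint-∨ : ∀ n {f g} → (∀ i → i < n → f i ≡ true → g i ≡ false) →
                   count n f + count n g ≡ count n (λ i → f i ∨ g i)
count-disjoint-∨ zero    _        = refl
count-disjoint-∨ (suc n) {f} {g} disjoint = begin
  ⟦ f 0 ⟧ + cf + (⟦ g 0 ⟧ + cg)   ≡⟨ interchange ⟦ f 0 ⟧ cf ⟦ g 0 ⟧ cg ⟩
  (⟦ f 0 ⟧ + ⟦ g 0 ⟧) + (cf + cg) ≡⟨ cong₂ _+_ (indicator-∨ (disjoint 0 z<s))
                                       (count-disjoint-∨ n (λ i i<n → disjoint (suc i) (s<s i<n))) ⟩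
  ⟦ f 0 ∨ g 0 ⟧ + count n (λ i → f (suc i) ∨ g (suc i)) ∎
  where
  open ≡-Reasoning
  cf cg : ℕ
  cf = count n (λ i → f (suc i))
  cg = count n (λ i → g (suc i))
  interchange : ∀ a b c d → a + b + (c + d) ≡ (a + c) + (b + d)
  interchange = solve-∀
  indicator-∨ : ∀ {b c} → (b ≡ true → c ≡ false) → ⟦ b ⟧ + ⟦ c ⟧ ≡ ⟦ b ∨ c ⟧
  indicator-∨ {false} {c}     _ = refl
  indicator-∨ {true}  {false} _ = refl
  indicator-∨ {true}  {true}  h with () ← h refl

count-disjoint : ∀ n {f g} → (∀ i → i < n → f i ≡ true → g i ≡ false) →
                 count n f + count n g ≤ n
count-disjoint n disjoint = ≤-trans (≤-reflexive (count-disjoint-∨ n disjoint)) (count-≤ n _)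

count-disjoint-cover : ∀ n {f g} → (∀ i → i < n → f i ≡ true → g i ≡ false) →
                       count n f + count n g ≡ n → ∀ i → i < n → g i ≡ false → f i ≡ true
count-disjoint-cover n {f} {g} disjoint total i i<n gi =
  trans (sym (∨-identityʳ (f i)))
        (trans (cong (f i ∨_) (sym gi))
               (count-full n _ (trans (sym (count-disjoint-∨ n disjoint)) total) i i<n))

count-complement : ∀ n {f g} → (∀ i → i < n → f i ≡ not (g i)) → count n f + count n g ≡ n
count-complement n {f} {g} f≡¬g =
  trans (count-disjoint-∨ n disjoint) (count-all n covers)
  where
  disjoint : ∀ i → i < n → f i ≡ true → g i ≡ false
  disjoint i i<n fi with g i | f≡¬g i i<n
  ... | false | _   = refl
  ... | true  | f≡false with () ← trans (sym fi) f≡false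
  covers : ∀ i → i < n → f i ∨ g i ≡ true
  covers i i<n = trans (cong (_∨ g i) (f≡¬g i i<n)) (∨-inverseˡ (g i))

count-prefix : ∀ α n {f} → (∀ j → j < α → f j ≡ true) →
               (∀ j → α ≤ j → j < α + n → f j ≡ false) → count (α + n) f ≡ α
count-prefix zero    n _   out = count-none n (λ j j<n → out j z≤n j<n)
count-prefix (suc α) n inn out rewrite inn 0 z<s =
  cong suc (count-prefix α n (λ j j<α → inn (suc j) (s<s j<α))
                             (λ j α≤j j<α+n → out (suc j) (s≤s α≤j) (s<s j<α+n)))

switch : ∀ (g : ℕ → Bool) lo d → g lo ≡ true → g (lo + d) ≡ false →
         ∃ λ t → t < d × g (lo + t) ≡ true × g (lo + suc t) ≡ false
switch g lo zero    glo gend with () ← trans (sym glo) (trans (cong g (sym (+-identityʳ lo))) gend)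
switch g lo (suc d) glo gend with g (lo + d) in gd
... | true  = d , ≤-refl , gd , gend
... | false with switch g lo d glo gd
...   | t , t<d , gt , gt+1 = t , m≤n⇒m≤1+n t<d , gt , gt+1

first-true : ∀ (g : ℕ → Bool) n → g n ≡ true →
             ∃ λ β → β ≤ n × g β ≡ true × (∀ t → t < β → g t ≡ false)
first-true g zero    gn = 0 , z≤n , gn , λ t ()
first-true g (suc n) gn with g 0 in g0
... | true  = 0 , z≤n , g0 , λ t ()
... | false with first-true (λ i → g (suc i)) n gn
...   | β , β≤n , gβ , before = suc β , s≤s β≤n , gβ , before′
  where
  before′ : ∀ t → t < suc β → g t ≡ false
  before′ zero    _   = g0
  before′ (suc t) t<β = before t (s<s⁻¹ t<β)

halve : ∀ n → n ≡ 2 * (n / 2) + n % 2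
halve n = trans (m≡m%n+[m/n]*n n 2) (rearrange (n % 2) (n / 2))
  where
  rearrange : ∀ c ℓ → c + ℓ * 2 ≡ 2 * ℓ + c
  rearrange = solve-∀

2*n≡n+n : ∀ n → 2 * n ≡ n + n
2*n≡n+n n = cong (n +_) (+-identityʳ n)

+-self-cancel-≤ : ∀ {a b} → a + a ≤ b + b → a ≤ b
+-self-cancel-≤ {a} {b} le = *-cancelˡ-≤ 2 (subst₂ _≤_ (sym (2*n≡n+n a)) (sym (2*n≡n+n b)) le)

half-bound : ∀ {ℓ c s} → c ≤ 1 → 2 * ℓ + c < s + s → ℓ + c ≤ s
half-bound {ℓ} {c} {s} c≤1 2ℓ+c<2s = *-cancelˡ-≤ 2 (begin
  2 * (ℓ + c)     ≡⟨ rearrange ℓ c ⟩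
  2 * ℓ + c + c   ≤⟨ +-monoʳ-≤ (2 * ℓ + c) c≤1 ⟩
  2 * ℓ + c + 1   ≡⟨ +-comm _ 1 ⟩
  suc (2 * ℓ + c) ≤⟨ 2ℓ+c<2s ⟩
  s + s           ≡⟨ 2*n≡n+n s ⟨
  2 * s           ∎)
  where
  open ≤-Reasoning
  rearrange : ∀ ℓ c → 2 * (ℓ + c) ≡ 2 * ℓ + c + c
  rearrange = solve-∀

module Periodic (m : ℕ) .{{_ : NonZero m}} where

  -- An m-periodic predicate on ℕ represents a subset of ℤ_m.
  Periodic : (ℕ → Bool) → Set
  Periodic f = ∀ a b → a % m ≡ b % m → f a ≡ f b

  card : (ℕ → Bool) → ℕ
  card = count m

  %-congˡ-+ : ∀ c {a b} → a % m ≡ b % m → (c + a) % m ≡ (c + b) % m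
  %-congˡ-+ c {a} {b} eq = begin
    (c + a) % m         ≡⟨ %-distribˡ-+ c a m ⟩
    (c % m + a % m) % m ≡⟨ cong (λ x → (c % m + x) % m) eq ⟩
    (c % m + b % m) % m ≡⟨ %-distribˡ-+ c b m ⟨
    (c + b) % m         ∎
    where open ≡-Reasoning

  %-congʳ-+ : ∀ c {a b} → a % m ≡ b % m → (a + c) % m ≡ (b + c) % m
  %-congʳ-+ c {a} {b} eq =
    trans (cong (_% m) (+-comm a c)) (trans (%-congˡ-+ c eq) (cong (_% m) (+-comm c b)))

  periodic-% : ∀ {f} → Periodic f → ∀ a → f (a % m) ≡ f a
  periodic-% per a = per (a % m) a (m%n%n≡m%n a m)

  periodic-m+ : ∀ {f} → Periodic f → ∀ a b → f (a + (m + b)) ≡ f (a + b)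
  periodic-m+ per a b = per _ _ (%-congˡ-+ a (trans (cong (_% m) (+-comm m b)) ([m+n]%n≡m%n b m)))

  periodic-pred : ∀ {f} → Periodic f → ∀ n → f (pred m + suc n) ≡ f n
  periodic-pred per n = per _ _ (begin
    (pred m + suc n) % m   ≡⟨ cong (_% m) (+-suc (pred m) n) ⟩
    (suc (pred m) + n) % m ≡⟨ cong (λ x → (x + n) % m) (suc-pred m) ⟩
    (m + n) % m            ≡⟨ cong (_% m) (+-comm m n) ⟩
    (n + m) % m            ≡⟨ [m+n]%n≡m%n n m ⟩
    n % m                  ∎)
    where open ≡-Reasoning

  shift : ℕ → (ℕ → Bool) → ℕ → Bool
  shift c f n = f (c + n)

  shift-periodic : ∀ {f} c → Periodic f → Periodic (shift c f)
  shift-periodic c per a b eq = per (c + a) (c + b) (%-congˡ-+ c eq)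

  card-shift : ∀ {f} → Periodic f → ∀ c → card (shift c f) ≡ card f
  card-shift per zero    = refl
  card-shift {f} per (suc c) = trans (card-shift (shift-periodic 1 per) c) rotate
    where
    open ≡-Reasoning
    f-m≡f-0 : f m ≡ f 0
    f-m≡f-0 = trans (cong f (sym (+-identityʳ m))) (periodic-m+ per 0 0)
    rotate : card (λ n → f (suc n)) ≡ card f
    rotate = +-cancelˡ-≡ ⟦ f 0 ⟧ _ _ (begin
      count (suc m) f  ≡⟨ count-snoc m f ⟩
      card f + ⟦ f m ⟧ ≡⟨ cong (λ b → card f + ⟦ b ⟧) f-m≡f-0 ⟩
      card f + ⟦ f 0 ⟧ ≡⟨ +-comm (card f) _ ⟩
      ⟦ f 0 ⟧ + card f ∎)

  -- expand X = X ∪ (X + 1), the sumset X + {0, 1}; pred m + n represents n - 1.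
  expand : (ℕ → Bool) → ℕ → Bool
  expand X n = X n ∨ X (pred m + n)

  expand-periodic : ∀ {X} → Periodic X → Periodic (expand X)
  expand-periodic per a b eq = cong₂ _∨_ (per a b eq) (per _ _ (%-congˡ-+ (pred m) eq))

  expand-⊇ : ∀ X {n} → X n ≡ true → expand X n ≡ true
  expand-⊇ X {n} xn = cong (_∨ X (pred m + n)) xn

  expand-from-pred : ∀ X {n} → X (pred m + n) ≡ true → expand X n ≡ true
  expand-from-pred X {n} xn-1 = trans (cong (X n ∨_) xn-1) (∨-zeroʳ (X n))

  Boundary : (ℕ → Bool) → ℕ → Set
  Boundary X e = e < m × X e ≡ false × X (pred m + e) ≡ true

  card-expand-< : ∀ {X e} → Boundary X e → card X < card (expand X)
  card-expand-< {X} (e<m , xe , xe-1) =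
    count-mono-< m (λ _ _ → expand-⊇ X) _ e<m xe (expand-from-pred X xe-1)

  card-expand-two : ∀ {X e e′} → Boundary X e → Boundary X e′ → e ≢ e′ →
                    2 + card X ≤ card (expand X)
  card-expand-two {X} {e} {e′} (e<m , xe , xe-1) (e′<m , xe′ , xe′-1) e≢e′ =
    ≤-trans (s≤s X<X+e) X+e<expand
    where
    is-e : ℕ → Bool
    is-e i with i ≟ e
    ... | yes _ = true
    ... | no _  = false
    X+e : ℕ → Bool
    X+e i = X i ∨ is-e i
    X+e-at-e : X+e e ≡ true
    X+e-at-e with e ≟ e
    ... | yes _   = ∨-zeroʳ (X e)
    ... | no e≢e = contradiction refl e≢e
    X+e-at-e′ : X+e e′ ≡ false
    X+e-at-e′ with e′ ≟ e
    ... | yes e′≡e = contradiction (sym e′≡e) e≢e′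
    ... | no _     = trans (∨-identityʳ (X e′)) xe′
    X+e⊆expand : X+e ⊆[ m ] expand X
    X+e⊆expand i _ x+e-i with i ≟ e
    ... | yes refl = expand-from-pred X xe-1
    ... | no _     = expand-⊇ X (trans (sym (∨-identityʳ (X i))) x+e-i)
    X<X+e : card X < card X+e
    X<X+e = count-mono-< m (λ i _ xi → cong (_∨ is-e i) xi) e e<m xe X+e-at-e
    X+e<expand : card X+e < card (expand X)
    X+e<expand = count-mono-< m X+e⊆expand e′ e′<m X+e-at-e′ (expand-from-pred X xe′-1)

  boundary-exists : ∀ {X u v} → Periodic X → u < m → X u ≡ true → X v ≡ false → ∃ (Boundary X)
  boundary-exists {X} {u} {v} per u<m xu xv = boundary (switch X u (v + (m ∸ u)) xu X-end)
    where
    swap : ∀ a b c → a + (b + c) ≡ b + (a + c)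
    swap = solve-∀
    X-end : X (u + (v + (m ∸ u))) ≡ false
    X-end = begin
      X (u + (v + (m ∸ u))) ≡⟨ cong X (swap u v (m ∸ u)) ⟩
      X (v + (u + (m ∸ u))) ≡⟨ cong (λ x → X (v + x)) (m+[n∸m]≡n (<⇒≤ u<m)) ⟩
      X (v + m)             ≡⟨ cong (λ x → X (v + x)) (sym (+-identityʳ m)) ⟩
      X (v + (m + 0))       ≡⟨ periodic-m+ per v 0 ⟩
      X (v + 0)             ≡⟨ cong X (+-identityʳ v) ⟩
      X v                   ≡⟨ xv ⟩
      false                 ∎
      where open ≡-Reasoning
    boundary : (∃ λ t → t < v + (m ∸ u) × X (u + t) ≡ true × X (u + suc t) ≡ false) →
               ∃ (Boundary X)
    boundary (t , _ , xt , xt+1) = e , m%n<n _ m , trans (periodic-% per _) xt+1 , xe-1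
      where
      e : ℕ
      e = (u + suc t) % m
      xe-1 : X (pred m + e) ≡ true
      xe-1 = begin
        X (pred m + e)             ≡⟨ per _ _ (%-congˡ-+ (pred m) (m%n%n≡m%n _ m)) ⟩
        X (pred m + (u + suc t))   ≡⟨ cong (λ x → X (pred m + x)) (+-suc u t) ⟩
        X (pred m + suc (u + t))   ≡⟨ periodic-pred per (u + t) ⟩
        X (u + t)                  ≡⟨ xt ⟩
        true                       ∎
        where open ≡-Reasoning

  wrap-around : ∀ {L j} → L ≤ m → m ∸ L ≤ j → j < m → ∃ λ t → t < L × L + j ≡ m + t
  wrap-around {L} {j} L≤m m-L≤j j<m = L + j ∸ m , t<L , L+j≡m+t
    where
    m≤L+j : m ≤ L + j
    m≤L+j = subst (_≤ L + j) (m+[n∸m]≡n L≤m) (+-monoʳ-≤ L m-L≤j)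
    L+j≡m+t : L + j ≡ m + (L + j ∸ m)
    L+j≡m+t = sym (m+[n∸m]≡n m≤L+j)
    t<L : L + j ∸ m < L
    t<L = +-cancelˡ-< m _ L (subst (_< m + L) L+j≡m+t (subst (L + j <_) (+-comm L m) (+-monoʳ-< L j<m)))

  Arc : (ℕ → Bool) → ℕ → ℕ → Set
  Arc X p α = (∀ j → j < α → X (p + j) ≡ true) × (∀ j → α ≤ j → j < m → X (p + j) ≡ false)

  card-arc : ∀ {X p α} → Periodic X → α ≤ m → Arc X p α → card X ≡ α
  card-arc {X} {p} {α} per α≤m (inside , outside) = begin
    card X                          ≡⟨ card-shift per p ⟨
    count m (shift p X)             ≡⟨ cong (λ n → count n (shift p X)) (m+[n∸m]≡n α≤m) ⟨
    count (α + (m ∸ α)) (shift p X) ≡⟨ count-prefix α (m ∸ α) inside outside′ ⟩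
    α                               ∎
    where
    open ≡-Reasoning
    outside′ : ∀ j → α ≤ j → j < α + (m ∸ α) → X (p + j) ≡ false
    outside′ j α≤j j<m = outside j α≤j (subst (j <_) (m+[n∸m]≡n α≤m) j<m)

  arc-expand : ∀ {X p α} → Periodic X → 1 ≤ α → α < m → Arc X p α → Arc (expand X) p (suc α)
  arc-expand {X} {p} {suc α} per _ _ (inside , outside) = inside′ , outside′
    where
    back : ∀ j → X (pred m + (p + suc j)) ≡ X (p + j)
    back j = trans (cong (λ x → X (pred m + x)) (+-suc p j)) (periodic-pred per (p + j))
    inside′ : ∀ j → j < suc (suc α) → expand X (p + j) ≡ true
    inside′ j j<α+2 with m≤n⇒m<n∨m≡n (s≤s⁻¹ j<α+2)
    ... | inj₁ j<α+1 = expand-⊇ X (inside j j<α+1)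
    ... | inj₂ refl  = expand-from-pred X (trans (back α) (inside α ≤-refl))
    outside′ : ∀ j → suc (suc α) ≤ j → j < m → expand X (p + j) ≡ false
    outside′ (suc j) (s≤s α+1≤j) j+1<m
      rewrite outside (suc j) (m≤n⇒m≤1+n α+1≤j) j+1<m | back j
            | outside j α+1≤j (<-trans (n<1+n j) j+1<m) = refl

  arc-shift : ∀ {X p q c α} → Periodic X → (c + q) % m ≡ p % m → Arc X p α → Arc (shift c X) q α
  arc-shift {X} {p} {q} {c} per c+q≡p (inside , outside) =
    (λ j j<α → trans (moved j) (inside j j<α)) ,
    (λ j α≤j j<m → trans (moved j) (outside j α≤j j<m))
    where
    moved : ∀ j → X (c + (q + j)) ≡ X (p + j)
    moved j = per _ _ (trans (cong (_% m) (sym (+-assoc c q j))) (%-congʳ-+ j c+q≡p))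

  arc-complement : ∀ {X Y q L} → Periodic X → L ≤ m → Arc X q L → (∀ n → Y n ≡ not (X n)) →
                   Arc Y (q + L) (m ∸ L)
  arc-complement {X} {Y} {q} {L} per L≤m (inside , outside) Y≡¬X = inside′ , outside′
    where
    Y-at : ∀ j → Y (q + L + j) ≡ not (X (q + (L + j)))
    Y-at j = trans (Y≡¬X _) (cong (λ x → not (X x)) (+-assoc q L j))
    inside′ : ∀ j → j < m ∸ L → Y (q + L + j) ≡ true
    inside′ j j<m-L = trans (Y-at j) (cong not
      (outside (L + j) (m≤m+n L j) (subst (L + j <_) (m+[n∸m]≡n L≤m) (+-monoʳ-< L j<m-L))))
    outside′ : ∀ j → m ∸ L ≤ j → j < m → Y (q + L + j) ≡ false
    outside′ j m-L≤j j<m with wrap-around L≤m m-L≤j j<m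
    ... | t , t<L , L+j≡m+t = trans (Y-at j) (cong not (begin
      X (q + (L + j)) ≡⟨ cong (λ x → X (q + x)) L+j≡m+t ⟩
      X (q + (m + t)) ≡⟨ periodic-m+ per q t ⟩
      X (q + t)       ≡⟨ inside t t<L ⟩
      true            ∎))
      where open ≡-Reasoning

  +-%-≢ : ∀ {e d} → e < m → 0 < d → d < m → e ≢ (e + d) % m
  +-%-≢ {e} {d} e<m 0<d d<m e≡ with e + d <? m
  ... | yes e+d<m = <⇒≢ (m<m+n e 0<d) (trans e≡ (m<n⇒m%n≡m e+d<m))
  ... | no  e+d≮m = <⇒≢ t<e (sym (trans e≡ e+d≡t))
    where
    m≤e+d : m ≤ e + d
    m≤e+d = ≮⇒≥ e+d≮m
    t<e : e + d ∸ m < e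
    t<e = +-cancelʳ-< m _ e (subst (_< e + m) (sym (m∸n+n≡m m≤e+d)) (+-monoʳ-< e d<m))
    e+d≡t : (e + d) % m ≡ e + d ∸ m
    e+d≡t = trans (sym (m≤n⇒[n∸m]%m≡n%m m≤e+d)) (m<n⇒m%n≡m (<-trans t<e e<m))

  -- Starting from a
  -- boundary point e, X is empty up to its first point e + β and full from there to e - 1,
  -- for a gap after e + β would be a second boundary point.
  thin-expansion⇒arc : ∀ {X e} → Periodic X → card (expand X) < 2 + card X → Boundary X e →
                       ∃₂ λ p α → α ≤ m × Arc X p α
  thin-expansion⇒arc {X} {e} per thin bd@(e<m , xe , xe-1)
    with first-true (λ t → X (e + t)) (pred m) (trans (cong X (+-comm e (pred m))) xe-1)
  ... | β , β≤m-1 , xβ , before = e + β , m ∸ β , m∸n≤m m β , inside , outside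
    where
    filled : ∀ j → β + j ≤ pred m → X (e + (β + j)) ≡ true
    filled zero    _       = trans (cong (λ x → X (e + x)) (+-identityʳ β)) xβ
    filled (suc j) β+j+1≤m-1 with X (e + (β + suc j)) in gap
    ... | true  = refl
    ... | false = contradiction (card-expand-two bd second e≢e+d) (<⇒≱ thin)
      where
      d : ℕ
      d = β + suc j
      0<d : 0 < d
      0<d = subst (0 <_) (sym (+-suc β j)) z<s
      e≢e+d : e ≢ (e + d) % m
      e≢e+d = +-%-≢ e<m 0<d (m≤pred[n]⇒suc[m]≤n β+j+1≤m-1)
      β+j≤m-1 : β + j ≤ pred m
      β+j≤m-1 = ≤-trans (n≤1+n _) (subst (_≤ pred m) (+-suc β j) β+j+1≤m-1)
      second : Boundary X ((e + d) % m)
      second = m%n<n _ m , trans (periodic-% per _) gap , (begin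
        X (pred m + (e + d) % m)          ≡⟨ per _ _ (%-congˡ-+ (pred m) (m%n%n≡m%n _ m)) ⟩
        X (pred m + (e + d))              ≡⟨ cong (λ x → X (pred m + x)) e+d≡1+e+β+j ⟩
        X (pred m + suc (e + (β + j)))    ≡⟨ periodic-pred per (e + (β + j)) ⟩
        X (e + (β + j))                   ≡⟨ filled j β+j≤m-1 ⟩
        true                              ∎)
        where
        open ≡-Reasoning
        e+d≡1+e+β+j : e + d ≡ suc (e + (β + j))
        e+d≡1+e+β+j = trans (cong (e +_) (+-suc β j)) (+-suc e (β + j))
    β≤m : β ≤ m
    β≤m = <⇒≤ (m≤pred[n]⇒suc[m]≤n β≤m-1)
    inside : ∀ j → j < m ∸ β → X (e + β + j) ≡ true
    inside j j<m-β = trans (cong X (+-assoc e β j))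
      (filled j (<⇒≤pred (subst (β + j <_) (m+[n∸m]≡n β≤m) (+-monoʳ-< β j<m-β))))
    outside : ∀ j → m ∸ β ≤ j → j < m → X (e + β + j) ≡ false
    outside j m-β≤j j<m with wrap-around β≤m m-β≤j j<m
    ... | t , t<β , β+j≡m+t = begin
      X (e + β + j)   ≡⟨ cong X (trans (+-assoc e β j) (cong (e +_) β+j≡m+t)) ⟩
      X (e + (m + t)) ≡⟨ periodic-m+ per e t ⟩
      X (e + t)       ≡⟨ before t t<β ⟩
      false           ∎
      where open ≡-Reasoning

  spread : ℕ → (ℕ → Bool) → ℕ → Bool
  spread zero    X = X
  spread (suc t) X = expand (spread t X)

  spread-periodic : ∀ {X} t → Periodic X → Periodic (spread t X)
  spread-periodic zero    per = per
  spread-periodic (suc t) per = expand-periodic (spread-periodic t per)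

  spread-⊇ : ∀ {X n} t → X n ≡ true → spread t X n ≡ true
  spread-⊇     zero    xn = xn
  spread-⊇ {X} (suc t) xn = expand-⊇ (spread t X) (spread-⊇ t xn)

  spread-source : ∀ {X} → Periodic X → ∀ t n → spread t X (t + n) ≡ true →
                  ∃ λ r → r ≤ t × X (r + n) ≡ true
  spread-source per zero    n xn = 0 , z≤n , xn
  spread-source {X} per (suc t) n hit with spread t X (suc t + n) in here
  ... | true with spread-source per t (suc n) (trans (cong (spread t X) (+-suc t n)) here)
  ...   | r , r≤t , x = suc r , s≤s r≤t , trans (cong X (sym (+-suc r n))) x
  spread-source {X} per (suc t) n hit | false
    with spread-source per t n (trans (sym (periodic-pred (spread-periodic t per) (t + n))) hit)
  ... | r , r≤t , x = r , m≤n⇒m≤1+n r≤t , x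

  spread-growth : ∀ {X u v} → Periodic X → u < m → X u ≡ true → ∀ t j →
                  spread (t + j) X v ≡ false → card (spread t X) + j ≤ card (spread (t + j) X)
  spread-growth {X} per u<m xu t zero miss
    rewrite +-identityʳ t | +-identityʳ (card (spread t X)) = ≤-refl
  spread-growth {X} {v = v} per u<m xu t (suc j) miss
    rewrite +-suc t j | +-suc (card (spread t X)) j =
    ≤-trans (s≤s (spread-growth per u<m xu t j miss′)) (card-expand-< (proj₂ boundary))
    where
    miss′ : spread (t + j) X v ≡ false
    miss′ = false-antitone (expand-⊇ (spread (t + j) X)) miss
    boundary : ∃ (Boundary (spread (t + j) X))
    boundary = boundary-exists (spread-periodic (t + j) per) u<m (spread-⊇ (t + j) xu) miss′

  spread-arc : ∀ {X p α} → Periodic X → 1 ≤ α → ∀ t → α + t ≤ m → Arc X p α →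
               Arc (spread t X) p (α + t)
  spread-arc {X} {p} {α} per 1≤α zero    _     arc = subst (Arc X p) (sym (+-identityʳ α)) arc
  spread-arc {X} {p} {α} per 1≤α (suc t) α+t<m arc =
    subst (Arc (spread (suc t) X) p) (sym (+-suc α t))
      (arc-expand (spread-periodic t per) (≤-trans 1≤α (m≤m+n α t))
                  (subst (_≤ m) (+-suc α t) α+t<m)
                  (spread-arc per 1≤α t (<⇒≤ (subst (_≤ m) (+-suc α t) α+t<m)) arc))

  CrossAgree : ℕ → (ℕ → Bool) → (ℕ → Bool) → Set
  CrossAgree s fA fB =
    ∀ a b → a < m → b < m → fA a ≡ true → fB b ≡ true → InAgreeRange m s ((a + (m ∸ b)) % m)

  offset-distance : ∀ d b → d < m → b < m → ((d + b) % m + (m ∸ b)) % m ≡ d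
  offset-distance d b d<m b<m = begin
    ((d + b) % m + (m ∸ b)) % m ≡⟨ %-congʳ-+ (m ∸ b) (m%n%n≡m%n (d + b) m) ⟩
    (d + b + (m ∸ b)) % m       ≡⟨ cong (_% m) (trans (+-assoc d b _) (cong (d +_) (m+[n∸m]≡n (<⇒≤ b<m)))) ⟩
    (d + m) % m                 ≡⟨ [m+n]%n≡m%n d m ⟩
    d % m                       ≡⟨ m<n⇒m%n≡m d<m ⟩
    d                           ∎
    where open ≡-Reasoning

  offset-to : ∀ q y → y < m → ∃ λ j → j < m × (q + j) % m ≡ y
  offset-to q y y<m = j , m%n<n _ m , (begin
    (q + j) % m                    ≡⟨ %-congʳ-+ j (m%n%n≡m%n q m) ⟨
    (q % m + j) % m                ≡⟨ %-congˡ-+ (q % m) (m%n%n≡m%n _ m) ⟩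
    (q % m + (y + (m ∸ q % m))) % m ≡⟨ cong (_% m) (rearrange (q % m) y (m ∸ q % m)) ⟩
    (y + (q % m + (m ∸ q % m))) % m ≡⟨ cong (λ x → (y + x) % m) (m+[n∸m]≡n (<⇒≤ (m%n<n q m))) ⟩
    (y + m) % m                    ≡⟨ [m+n]%n≡m%n y m ⟩
    y % m                          ≡⟨ m<n⇒m%n≡m y<m ⟩
    y                              ∎)
    where
    open ≡-Reasoning
    j : ℕ
    j = (y + (m ∸ q % m)) % m
    rearrange : ∀ a b c → a + (b + c) ≡ b + (a + c)
    rearrange = solve-∀

  arc-member : ∀ {X p α} → Arc X p α → ∀ j → j < m → X (p + j) ≡ true → j < α
  arc-member {α = α} (_ , outside) j j<m xj with j <? α
  ... | yes j<α = j<α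
  ... | no  j≮α with () ← trans (sym xj) (outside j (≮⇒≥ j≮α) j<m)

outside-agree-range : ∀ {m s d} → s ≤ d → d + s ≤ m → ¬ InAgreeRange m s d
outside-agree-range s≤d _     (inj₁ d<s)   = <⇒≱ d<s s≤d
outside-agree-range _   d+s≤m (inj₂ m<d+s) = <⇒≱ m<d+s d+s≤m

module CrossAgreement (m : ℕ) .{{_ : NonZero m}} (s k : ℕ) (1≤s : 1 ≤ s) (m≡2s+k : s + s + k ≡ m)
  {fA fB : ℕ → Bool} (perA : Periodic.Periodic m fA) (perB : Periodic.Periodic m fB)
  (cross : Periodic.CrossAgree m s fA fB) where
  open Periodic m

  -- far n = spread k fA (k + s + n): the points n with n - s - r ∈ A for some r ≤ k,
  -- i.e. the translate of A + {0, …, k} by s.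
  far : ℕ → Bool
  far = shift (k + s) (spread k fA)

  far-periodic : Periodic far
  far-periodic = shift-periodic (k + s) (spread-periodic k perA)

  card-far : card far ≡ card (spread k fA)
  card-far = card-shift (spread-periodic k perA) (k + s)

  -- A point b ∈ B in far would lie at distance s + r (r ≤ k) from a point of A, which is
  -- outside the agreement range.
  B-avoids-far< : ∀ b → b < m → fB b ≡ true → far b ≡ false
  B-avoids-far< b b<m fb with far b in hit
  ... | false = refl
  ... | true with spread-source perA k (s + b) (trans (cong (spread k fA) (sym (+-assoc k s b))) hit)
  ...   | r , r≤k , fA-at = contradiction agree (outside-agree-range (m≤n+m s r) d+s≤m)
    where
    d : ℕ
    d = r + s
    d+s≤m : d + s ≤ m
    d+s≤m = subst (d + s ≤_) (trans (rearrange k s) m≡2s+k) (+-monoˡ-≤ s (+-monoˡ-≤ s r≤k))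
      where
      rearrange : ∀ k s → k + s + s ≡ s + s + k
      rearrange = solve-∀
    d<m : d < m
    d<m = <-≤-trans (m<m+n d 1≤s) d+s≤m
    fA-at′ : fA ((d + b) % m) ≡ true
    fA-at′ = trans (periodic-% perA (d + b)) (trans (cong fA (+-assoc r s b)) fA-at)
    agree : InAgreeRange m s d
    agree = subst (InAgreeRange m s) (offset-distance d b d<m b<m)
              (cross _ b (m%n<n (d + b) m) b<m fA-at′ fb)

  B-avoids-far : ∀ b → fB b ≡ true → far b ≡ false
  B-avoids-far b fb = trans (sym (periodic-% far-periodic b))
    (B-avoids-far< (b % m) (m%n<n b m) (trans (periodic-% perB b) fb))

  card-B+far≤m : card fB + card far ≤ m
  card-B+far≤m = count-disjoint m (λ i _ → B-avoids-far i)

  A-misses : ∀ {b} → fB b ≡ true → spread k fA (k + s + b) ≡ false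
  A-misses {b} fb = B-avoids-far b fb

  lower-chain : ∀ {a₀ b₀} → a₀ < m → fA a₀ ≡ true → fB b₀ ≡ true →
                card fA + card fB + k ≤ card fB + card far
  lower-chain {a₀} {b₀} a₀<m fa₀ fb₀ = begin
    card fA + card fB + k        ≡⟨ rearrange (card fA) (card fB) k ⟩
    card fB + (card fA + k)      ≤⟨ +-monoʳ-≤ (card fB) (spread-growth perA a₀<m fa₀ 0 k (A-misses fb₀)) ⟩
    card fB + card (spread k fA) ≡⟨ cong (card fB +_) card-far ⟨
    card fB + card far           ∎
    where
    open ≤-Reasoning
    rearrange : ∀ a b c → a + b + c ≡ b + (a + c)
    rearrange = solve-∀

  cross-bound : ∀ {a₀ b₀} → a₀ < m → fA a₀ ≡ true → fB b₀ ≡ true → card fA + card fB ≤ s + s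
  cross-bound a₀<m fa₀ fb₀ = +-cancelʳ-≤ k _ _ (begin
    card fA + card fB + k ≤⟨ lower-chain a₀<m fa₀ fb₀ ⟩
    card fB + card far    ≤⟨ card-B+far≤m ⟩
    m                     ≡⟨ m≡2s+k ⟨
    s + s + k             ∎)
    where open ≤-Reasoning

  module Tight {a₀ b₀} (a₀<m : a₀ < m) (b₀<m : b₀ < m) (fa₀ : fA a₀ ≡ true) (fb₀ : fB b₀ ≡ true)
               (1≤k : 1 ≤ k) (tight : card fA + card fB ≡ s + s) where

    m≤B+far : m ≤ card fB + card far
    m≤B+far = begin
      m                     ≡⟨ m≡2s+k ⟨
      s + s + k             ≡⟨ cong (_+ k) tight ⟨
      card fA + card fB + k ≤⟨ lower-chain a₀<m fa₀ fb₀ ⟩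
      card fB + card far    ∎
      where open ≤-Reasoning

    -- A single expansion step of A gains exactly one point: a gain of two would propagate
    -- through all k steps and push |B| + |far| beyond m.
    expansion-thin : card (expand fA) < 2 + card fA
    expansion-thin = ≰⇒> thick⇒⊥
      where
      k′ : ℕ
      k′ = k ∸ 1
      1+k′≡k : suc k′ ≡ k
      1+k′≡k = m+[n∸m]≡n 1≤k
      miss : spread (1 + k′) fA (k + s + b₀) ≡ false
      miss = subst (λ t → spread t fA (k + s + b₀) ≡ false) (sym 1+k′≡k) (A-misses fb₀)
      growth : card (expand fA) + k′ ≤ card (spread k fA)
      growth = subst (λ t → card (expand fA) + k′ ≤ card (spread t fA)) 1+k′≡k
        (spread-growth perA a₀<m fa₀ 1 k′ miss)
      rearrange : ∀ a b c → suc (a + b + suc c) ≡ b + (2 + a + c)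
      rearrange = solve-∀
      thick⇒⊥ : ¬ (2 + card fA ≤ card (expand fA))
      thick⇒⊥ thick = <-irrefl refl (begin-strict
        card fB + card far         ≤⟨ card-B+far≤m ⟩
        m                          ≡⟨ m≡2s+k ⟨
        s + s + k                  ≡⟨ cong₂ _+_ (sym tight) (sym 1+k′≡k) ⟩
        card fA + card fB + suc k′ <⟨ n<1+n _ ⟩
        suc (card fA + card fB + suc k′) ≡⟨ rearrange (card fA) (card fB) k′ ⟩
        card fB + (2 + card fA + k′) ≤⟨ +-monoʳ-≤ (card fB) (≤-trans (+-monoˡ-≤ k′ thick) growth) ⟩
        card fB + card (spread k fA) ≡⟨ cong (card fB +_) card-far ⟨
        card fB + card far         ∎)
        where open ≤-Reasoning

    B-complements-far : ∀ n → fB n ≡ not (far n)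
    B-complements-far n = trans (sym (periodic-% perB n))
      (trans (below-m (n % m) (m%n<n n m)) (cong not (periodic-% far-periodic n)))
      where
      cover : ∀ i → i < m → far i ≡ false → fB i ≡ true
      cover = count-disjoint-cover m (λ i _ → B-avoids-far i) (≤-antisym card-B+far≤m m≤B+far)
      below-m : ∀ i → i < m → fB i ≡ not (far i)
      below-m i i<m with far i in far-i
      ... | false = cover i i<m far-i
      ... | true  = false-antitone (λ fb → trans (sym (B-avoids-far i fb)) far-i) refl

    -- A is an arc: it has a boundary point (it contains a₀ and misses k + s + b₀), and its
    -- expansion is thin.
    A-arc : ∃₂ λ p α → α ≤ m × Arc fA p α
    A-arc = thin-expansion⇒arc perA expansion-thin (proj₂ (boundary-exists perA a₀<m fa₀ A-gap))
      where
      A-gap : fA (k + s + b₀) ≡ false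
      A-gap = false-antitone (spread-⊇ k) (A-misses fb₀)

    arcs-from-A : ∀ p α → α ≤ m → Arc fA p α →
                  α < s + s × Arc fB (p + s + (α + k)) (s + s ∸ α)
    arcs-from-A p α α≤m arcA = α<2s , subst (Arc fB (p + s + (α + k))) m-[α+k]≡2s-α arcB
      where
      card-A≡α : card fA ≡ α
      card-A≡α = card-arc perA α≤m arcA
      α<2s : α < s + s
      α<2s = begin-strict
        α                 ≡⟨ +-identityʳ α ⟨
        α + 0             <⟨ +-monoʳ-< α (count-member m b₀ b₀<m fb₀) ⟩
        α + card fB       ≡⟨ cong (_+ card fB) card-A≡α ⟨
        card fA + card fB ≡⟨ tight ⟩
        s + s             ∎
        where open ≤-Reasoning
      α+k≤m : α + k ≤ m
      α+k≤m = subst (α + k ≤_) m≡2s+k (+-monoˡ-≤ k (<⇒≤ α<2s))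
      1≤α : 1 ≤ α
      1≤α = subst (1 ≤_) card-A≡α (count-member m a₀ a₀<m fa₀)
      far-start : (k + s + (p + s)) % m ≡ p % m
      far-start = trans (cong (_% m) (trans (rearrange k s p) (cong (p +_) m≡2s+k))) ([m+n]%n≡m%n p m)
        where
        rearrange : ∀ k s p → k + s + (p + s) ≡ p + (s + s + k)
        rearrange = solve-∀
      far-arc : Arc far (p + s) (α + k)
      far-arc = arc-shift {X = spread k fA} {c = k + s} (spread-periodic k perA) far-start
                          (spread-arc perA 1≤α k α+k≤m arcA)
      arcB : Arc fB (p + s + (α + k)) (m ∸ (α + k))
      arcB = arc-complement {X = far} {Y = fB} far-periodic α+k≤m far-arc B-complements-far
      m-[α+k]≡2s-α : m ∸ (α + k) ≡ s + s ∸ α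
      m-[α+k]≡2s-α = trans (cong₂ _∸_ (trans (sym m≡2s+k) (+-comm (s + s) k)) (+-comm α k))
                           ([m+n]∸[m+o]≡n∸o k (s + s) α)

    tight-arcs : ∃₂ λ p α → α < s + s × Arc fA p α × Arc fB (p + s + (α + k)) (s + s ∸ α)
    tight-arcs = let (p , α , α≤m , arcA) = A-arc
                     (α<2s , arcB) = arcs-from-A p α α≤m arcA
                 in p , α , α<2s , arcA , arcB

-- A vector of booleans read as a predicate on ℕ (false beyond its length).
at : ∀ {n} → Vec Bool n → ℕ → Bool
at []      _       = false
at (x ∷ v) zero    = x
at (x ∷ v) (suc i) = at v i

count-at : ∀ {n} (v : Vec Bool n) → count n (at v) ≡ ∣ v ∣
count-at []          = refl
count-at (true ∷ v)  = cong suc (count-at v)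
count-at (false ∷ v) = count-at v

at-lookup : ∀ {n} (v : Vec Bool n) i (i<n : i < n) → at v i ≡ lookup v (fromℕ< i<n)
at-lookup (x ∷ v) zero    _   = refl
at-lookup (x ∷ v) (suc i) i<n = at-lookup v i (s<s⁻¹ i<n)

∉⇔lookup : ∀ {n} (A : Subset n) y → y ∉ A ⇔ lookup A y ≡ false
∉⇔lookup A y = mk⇔ to from
  where
  to : y ∉ A → lookup A y ≡ false
  to y∉A with lookup A y in eq
  ... | false = refl
  ... | true  = contradiction (lookup⇒[]= y A eq) y∉A
  from : lookup A y ≡ false → y ∉ A
  from eq y∈A with () ← trans (sym ([]=⇒lookup y∈A)) eq

module Indicator (m : ℕ) .{{_ : NonZero m}} where
  open Periodic m

  χ : Subset m → ℕ → Bool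
  χ A n = lookup A (fromℕ< (m%n<n n m))

  χ-periodic : ∀ A → Periodic (χ A)
  χ-periodic A a b eq = cong (lookup A) (fromℕ<-cong _ _ eq _ _)

  χ-< : ∀ A i (i<m : i < m) → χ A i ≡ lookup A (fromℕ< i<m)
  χ-< A i i<m = cong (lookup A) (fromℕ<-cong _ _ (m<n⇒m%n≡m i<m) _ _)

  χ-toℕ : ∀ A x → χ A (toℕ x) ≡ lookup A x
  χ-toℕ A x = trans (χ-< A (toℕ x) (toℕ<n x)) (cong (lookup A) (fromℕ<-toℕ x _))

  ∈⇔χ : ∀ A x → x ∈ A ⇔ χ A (toℕ x) ≡ true
  ∈⇔χ A x = mk⇔ (λ x∈A → trans (χ-toℕ A x) ([]=⇒lookup x∈A))
                (λ χx → lookup⇒[]= x A (trans (sym (χ-toℕ A x)) χx))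

  ∉⇔χ : ∀ A x → x ∉ A ⇔ χ A (toℕ x) ≡ false
  ∉⇔χ A x = mk⇔ (λ x∉A → trans (χ-toℕ A x) (Equivalence.to (∉⇔lookup A x) x∉A))
                (λ χx → Equivalence.from (∉⇔lookup A x) (trans (sym (χ-toℕ A x)) χx))

  χ-addMod : ∀ A x c → χ A (c + toℕ x) ≡ lookup A (addMod m x c)
  χ-addMod A x c = cong (χ A) (+-comm c (toℕ x))

  card-χ : ∀ A → ∣ A ∣ ≡ card (χ A)
  card-χ A = trans (sym (count-at A)) (count-cong m (λ i i<m → trans (at-lookup A i i<m) (sym (χ-< A i i<m))))

  cross-χ : ∀ {s A B} → CrossAgreeing m s A B → CrossAgree s (χ A) (χ B)
  cross-χ {s} {A} {B} agree a b a<m b<m χa χb =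
    subst (InAgreeRange m s) (cong₂ (λ x y → (x + (m ∸ y)) % m) (toℕ-fromℕ< a<m) (toℕ-fromℕ< b<m))
      (agree (fromℕ< a<m) (fromℕ< b<m) (member A a<m χa) (member B b<m χb))
    where
    member : ∀ C {i} (i<m : i < m) → χ C i ≡ true → fromℕ< i<m ∈ C
    member C {i} i<m χi = lookup⇒[]= _ C (trans (sym (χ-< C i i<m)) χi)

  arc⇒run : ∀ A {q len} → Arc (χ A) q len → ∀ x ℓ → (toℕ x + (m ∸ ℓ)) % m ≡ q % m →
            RunFrom m x ℓ len A
  arc⇒run A {q} {len} arc x ℓ start y = mk⇔ to from
    where
    c : ℕ
    c = toℕ x + (m ∸ ℓ)
    same : ∀ j → χ A (c + j) ≡ χ A (q + j)
    same j = χ-periodic A _ _ (%-congʳ-+ j start)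
    to : y ∈ A → ∃ λ j → j < len × toℕ y ≡ (c + j) % m
    to y∈A with offset-to q (toℕ y) (toℕ<n y)
    ... | j , j<m , q+j≡y = j , arc-member {X = χ A} arc j j<m χ-at , sym (trans (%-congʳ-+ j start) q+j≡y)
      where
      χ-at : χ A (q + j) ≡ true
      χ-at = trans (χ-periodic A _ _ (trans q+j≡y (sym (m<n⇒m%n≡m (toℕ<n y)))))
                   (Equivalence.to (∈⇔χ A y) y∈A)
    from : (∃ λ j → j < len × toℕ y ≡ (c + j) % m) → y ∈ A
    from (j , j<len , y≡) = Equivalence.from (∈⇔χ A y)
      (trans (cong (χ A) y≡) (trans (periodic-% (χ-periodic A) (c + j)) (trans (same j) (proj₁ arc j j<len))))

  point : ℕ → Fin m
  point n = fromℕ< (m%n<n n m)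

  point-offset : ∀ n r → (toℕ (point n) + r) % m ≡ (n + r) % m
  point-offset n r = trans (cong (λ y → (y + r) % m) (toℕ-fromℕ< (m%n<n n m))) (%-congʳ-+ r (m%n%n≡m%n n m))

  -- With m = 2s + k and ℓ + ℓ′ + c = s, arcs of A at p of length 2ℓ + c and of B at
  -- p + s + (2ℓ + c + k) of length 2ℓ′ + c are runs about the common centre p + ℓ.
  centred-runs : ∀ {s k} → s + s + k ≡ m → ∀ A B p ℓ ℓ′ c → ℓ + ℓ′ + c ≡ s →
    Arc (χ A) p (2 * ℓ + c) → Arc (χ B) (p + s + (2 * ℓ + c + k)) (2 * ℓ′ + c) →
    RunFrom m (point (p + ℓ)) ℓ (2 * ℓ + c) A × RunFrom m (point (p + ℓ)) ℓ′ (2 * ℓ′ + c) B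
  centred-runs {s} {k} m≡2s+k A B p ℓ ℓ′ c split arcA arcB =
    arc⇒run A arcA (point (p + ℓ)) ℓ startA , arc⇒run B arcB (point (p + ℓ)) ℓ′ startB
    where
    m≡ℓ′+rest : m ≡ ℓ′ + (s + ℓ + c + k)
    m≡ℓ′+rest = trans (sym m≡2s+k) (trans (cong (λ z → s + z + k) (sym split)) (rearrange s ℓ ℓ′ c k))
      where
      rearrange : ∀ s ℓ ℓ′ c k → s + (ℓ + ℓ′ + c) + k ≡ ℓ′ + (s + ℓ + c + k)
      rearrange = solve-∀
    ℓ≤m : ℓ ≤ m
    ℓ≤m = subst (ℓ ≤_) (sym m≡ℓ′+rest)
            (≤-trans (m≤n+m ℓ s) (≤-trans (m≤m+n _ c) (≤-trans (m≤m+n _ k) (m≤n+m _ ℓ′))))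
    startA : (toℕ (point (p + ℓ)) + (m ∸ ℓ)) % m ≡ p % m
    startA = trans (point-offset (p + ℓ) (m ∸ ℓ))
      (trans (cong (_% m) (trans (+-assoc p ℓ _) (cong (p +_) (m+[n∸m]≡n ℓ≤m)))) ([m+n]%n≡m%n p m))
    startB : (toℕ (point (p + ℓ)) + (m ∸ ℓ′)) % m ≡ (p + s + (2 * ℓ + c + k)) % m
    startB = trans (point-offset (p + ℓ) (m ∸ ℓ′)) (cong (_% m) (begin
      p + ℓ + (m ∸ ℓ′)               ≡⟨ cong (λ z → p + ℓ + (z ∸ ℓ′)) m≡ℓ′+rest ⟩
      p + ℓ + (ℓ′ + (s + ℓ + c + k) ∸ ℓ′) ≡⟨ cong (p + ℓ +_) (m+n∸m≡n ℓ′ _) ⟩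
      p + ℓ + (s + ℓ + c + k)        ≡⟨ rearrange p ℓ s c k ⟩
      p + s + (2 * ℓ + c + k)        ∎))
      where
      open ≡-Reasoning
      rearrange : ∀ p ℓ s c k → p + ℓ + (s + ℓ + c + k) ≡ p + s + (2 * ℓ + c + k)
      rearrange = solve-∀

  -- Runs about a common centre whose lengths 2ℓ + c and 2ℓ′ + c have the same parity c
  -- are intervals with the same centre: a point if c = 1, a half-point if c = 0.
  same-centre : ∀ {A B} x ℓ ℓ′ c → c ≤ 1 → 2 * ℓ + c < m → 2 * ℓ′ + c < m →
    RunFrom m x ℓ (2 * ℓ + c) A → RunFrom m x ℓ′ (2 * ℓ′ + c) B → SameCenterIntervals m A B
  same-centre {A} {B} x ℓ ℓ′ zero _ lt lt′ runA runB =
    x , inj₂ ((ℓ  , subst (_< m) (+-identityʳ _) lt  , subst (λ n → RunFrom m x ℓ n A) (+-identityʳ _) runA) ,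
              (ℓ′ , subst (_< m) (+-identityʳ _) lt′ , subst (λ n → RunFrom m x ℓ′ n B) (+-identityʳ _) runB))
  same-centre x ℓ ℓ′ (suc zero) _ lt lt′ runA runB = x , inj₁ ((ℓ , lt , runA) , (ℓ′ , lt′ , runB))
  same-centre x ℓ ℓ′ (suc (suc c)) (s≤s ()) _ _ _ _

  arcs⇒same-centre : ∀ {s k} → s + s + k ≡ m → s + s < m → ∀ A B p α → α < s + s →
    Arc (χ A) p α → Arc (χ B) (p + s + (α + k)) (s + s ∸ α) → SameCenterIntervals m A B
  arcs⇒same-centre {s} {k} m≡2s+k 2s<m A B p α α<2s arcA arcB =
    same-centre (point (p + ℓ)) ℓ ℓ′ c c≤1 lenA<m lenB<m (proj₁ runs) (proj₂ runs)
    where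
    ℓ c : ℕ
    ℓ = α / 2
    c = α % 2
    c≤1 : c ≤ 1
    c≤1 = s≤s⁻¹ (m%n<n α 2)
    α≡2ℓ+c : α ≡ 2 * ℓ + c
    α≡2ℓ+c = halve α
    ℓ′ : ℕ
    ℓ′ = s ∸ (ℓ + c)
    split : ℓ + ℓ′ + c ≡ s
    split = trans (swap ℓ ℓ′ c) (m+[n∸m]≡n (half-bound {ℓ} {c} {s} c≤1 (subst (_< s + s) α≡2ℓ+c α<2s)))
      where
      swap : ∀ a b c → a + b + c ≡ a + c + b
      swap = solve-∀
    2s-α≡2ℓ′+c : s + s ∸ α ≡ 2 * ℓ′ + c
    2s-α≡2ℓ′+c = trans (cong (_∸ α) 2s≡α+[2ℓ′+c]) (m+n∸m≡n α _)
      where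
      rearrange : ∀ ℓ ℓ′ c → (ℓ + ℓ′ + c) + (ℓ + ℓ′ + c) ≡ (2 * ℓ + c) + (2 * ℓ′ + c)
      rearrange = solve-∀
      2s≡α+[2ℓ′+c] : s + s ≡ α + (2 * ℓ′ + c)
      2s≡α+[2ℓ′+c] = trans (cong₂ _+_ (sym split) (sym split))
                           (trans (rearrange ℓ ℓ′ c) (cong (_+ (2 * ℓ′ + c)) (sym α≡2ℓ+c)))
    lenA<m : 2 * ℓ + c < m
    lenA<m = subst (_< m) α≡2ℓ+c (<-trans α<2s 2s<m)
    lenB<m : 2 * ℓ′ + c < m
    lenB<m = ≤-<-trans (subst (_≤ s + s) 2s-α≡2ℓ′+c (m∸n≤m (s + s) α)) 2s<m
    runs : RunFrom m (point (p + ℓ)) ℓ (2 * ℓ + c) A × RunFrom m (point (p + ℓ)) ℓ′ (2 * ℓ′ + c) B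
    runs = centred-runs m≡2s+k A B p ℓ ℓ′ c split (subst (Arc (χ A) p) α≡2ℓ+c arcA)
             (subst₂ (Arc (χ B)) (cong (λ a → p + s + (a + k)) α≡2ℓ+c) 2s-α≡2ℓ′+c arcB)

module Regimes (m : ℕ) .{{_ : NonZero m}} (s : ℕ) (1≤s : 1 ≤ s) where
  open Periodic m
  open Indicator m

  cards : ∀ A B → ∣ A ∣ + ∣ B ∣ ≡ card (χ A) + card (χ B)
  cards A B = cong₂ _+_ (card-χ A) (card-χ B)

  cross-case : 2 * s < m → (A B : Subset m) → Nonempty A → Nonempty B → CrossAgreeing m s A B →
               (∣ A ∣ + ∣ B ∣ ≤ 2 * s) × (∣ A ∣ + ∣ B ∣ ≡ 2 * s → SameCenterIntervals m A B)
  cross-case 2s<m A B (a , a∈A) (b , b∈B) agree = bound , equality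
    where
    s+s<m : s + s < m
    s+s<m = subst (_< m) (2*n≡n+n s) 2s<m
    k : ℕ
    k = m ∸ (s + s)
    m≡2s+k : s + s + k ≡ m
    m≡2s+k = m+[n∸m]≡n (<⇒≤ s+s<m)
    open CrossAgreement m s k 1≤s m≡2s+k (χ-periodic A) (χ-periodic B) (cross-χ agree)
    χa : χ A (toℕ a) ≡ true
    χa = Equivalence.to (∈⇔χ A a) a∈A
    χb : χ B (toℕ b) ≡ true
    χb = Equivalence.to (∈⇔χ B b) b∈B
    bound : ∣ A ∣ + ∣ B ∣ ≤ 2 * s
    bound = subst₂ _≤_ (sym (cards A B)) (sym (2*n≡n+n s)) (cross-bound (toℕ<n a) χa χb)
    equality : ∣ A ∣ + ∣ B ∣ ≡ 2 * s → SameCenterIntervals m A B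
    equality total =
      let (p , α , α<2s , arcA , arcB) = Tight.tight-arcs (toℕ<n a) (toℕ<n b) χa χb (m<n⇒0<n∸m s+s<m)
                                           (trans (sym (cards A B)) (trans total (2*n≡n+n s)))
      in arcs⇒same-centre m≡2s+k s+s<m A B p α α<2s arcA arcB

  agreeing-case : 2 * s < m → (A : Subset m) → Agreeing m s A →
                  (∣ A ∣ ≤ s) × (∣ A ∣ ≡ s → IsInterval m A)
  agreeing-case 2s<m A agree with nonempty? A
  ... | yes ne = +-self-cancel-≤ (subst (∣ A ∣ + ∣ A ∣ ≤_) (2*n≡n+n s) (proj₁ both)) ,
                 λ size → interval (proj₂ both (trans (cong₂ _+_ size size) (sym (2*n≡n+n s))))
    where
    both : (∣ A ∣ + ∣ A ∣ ≤ 2 * s) × (∣ A ∣ + ∣ A ∣ ≡ 2 * s → SameCenterIntervals m A A)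
    both = cross-case 2s<m A A ne ne agree
    interval : SameCenterIntervals m A A → IsInterval m A
    interval (x , inj₁ (odd , _))  = x , inj₁ odd
    interval (x , inj₂ (even , _)) = x , inj₂ even
  ... | no empty = subst (_≤ s) (sym size≡0) z≤n ,
                   λ size → contradiction (trans (sym size) size≡0) (>⇒≢ 1≤s)
    where
    size≡0 : ∣ A ∣ ≡ 0
    size≡0 = trans (cong ∣_∣ (Empty-unique empty)) (∣⊥∣≡0 m)

  module Half (2s≡m : 2 * s ≡ m) (A B : Subset m) (agree : CrossAgreeing m s A B) where
    open CrossAgreement m s 0 1≤s (trans (+-identityʳ _) (trans (sym (2*n≡n+n s)) 2s≡m))
           (χ-periodic A) (χ-periodic B) (cross-χ agree)

    far-addMod : ∀ x → far (toℕ x) ≡ lookup A (addMod m x s)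
    far-addMod x = χ-addMod A x s

    -- |far| = |A|, so the counting bound for B and far is the bound for A and B.
    sizes : ∣ A ∣ + ∣ B ∣ ≡ card (χ B) + card far
    sizes = trans (cards A B) (trans (+-comm (card (χ A)) (card (χ B))) (cong (card (χ B) +_) (sym card-far)))
    bound : ∣ A ∣ + ∣ B ∣ ≤ 2 * s
    bound = subst₂ _≤_ (sym sizes) (sym 2s≡m) card-B+far≤m

    -- If the bound is attained, B and A + s cover ℤ_m, so B is exactly the complement.
    complement : ∣ A ∣ + ∣ B ∣ ≡ 2 * s → ∀ x → (x ∈ B) ⇔ (addMod m x s ∉ A)
    complement total x = mk⇔ to from
      where
      cover : ∀ i → i < m → far i ≡ false → χ B i ≡ true
      cover = count-disjoint-cover m (λ i _ → B-avoids-far i) (trans (sym sizes) (trans total 2s≡m))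
      to : x ∈ B → addMod m x s ∉ A
      to x∈B = Equivalence.from (∉⇔lookup A _)
        (trans (sym (far-addMod x)) (B-avoids-far (toℕ x) (Equivalence.to (∈⇔χ B x) x∈B)))
      from : addMod m x s ∉ A → x ∈ B
      from x+s∉A = Equivalence.from (∈⇔χ B x)
        (cover (toℕ x) (toℕ<n x) (trans (far-addMod x) (Equivalence.to (∉⇔lookup A _) x+s∉A)))

    total : (∀ x → (x ∈ B) ⇔ (addMod m x s ∉ A)) → ∣ A ∣ + ∣ B ∣ ≡ 2 * s
    total compl = trans sizes (trans (count-complement m pointwise) (sym 2s≡m))
      where
      at-point : ∀ x → χ B (toℕ x) ≡ not (lookup A (addMod m x s))
      at-point x with lookup A (addMod m x s) in hit
      ... | true  = Equivalence.to (∉⇔χ B x) (λ x∈B → Equivalence.to (compl x) x∈B (lookup⇒[]= _ A hit))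
      ... | false = Equivalence.to (∈⇔χ B x) (Equivalence.from (compl x) (Equivalence.from (∉⇔lookup A _) hit))
      pointwise : ∀ i → i < m → χ B i ≡ not (far i)
      pointwise i i<m = subst (λ j → χ B j ≡ not (far j)) (toℕ-fromℕ< i<m)
        (trans (at-point (fromℕ< i<m)) (cong not (sym (far-addMod (fromℕ< i<m)))))

  half-case : 2 * s ≡ m → (A B : Subset m) → CrossAgreeing m s A B →
              (∣ A ∣ + ∣ B ∣ ≤ 2 * s) ×
              ((∣ A ∣ + ∣ B ∣ ≡ 2 * s) ⇔ (∀ x → (x ∈ B) ⇔ (addMod m x s ∉ A)))
  half-case 2s≡m A B agree = bound , mk⇔ complement total
    where open Half 2s≡m A B agree

  half-agreeing : 2 * s ≡ m → (A : Subset m) → Agreeing m s A →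
                  (∣ A ∣ ≤ s) × (∣ A ∣ ≡ s → ∀ x → (x ∈ A) ⇔ (addMod m x s ∉ A))
  half-agreeing 2s≡m A agree =
    +-self-cancel-≤ (subst (∣ A ∣ + ∣ A ∣ ≤_) (2*n≡n+n s) (proj₁ both)) ,
    λ size → Equivalence.to (proj₂ both) (trans (cong₂ _+_ size size) (sym (2*n≡n+n s)))
    where
    both : (∣ A ∣ + ∣ A ∣ ≤ 2 * s) ×
           ((∣ A ∣ + ∣ A ∣ ≡ 2 * s) ⇔ (∀ x → (x ∈ A) ⇔ (addMod m x s ∉ A)))
    both = half-case 2s≡m A A agree

lemma3p5 : (m s : ℕ) .{{_ : NonZero m}} → 1 ≤ s →
    ((2 * s < m) →
      ((A B : Subset m) → Nonempty A → Nonempty B → CrossAgreeing m s A B →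
        (∣ A ∣ + ∣ B ∣ ≤ 2 * s)
        × (∣ A ∣ + ∣ B ∣ ≡ 2 * s → SameCenterIntervals m A B))
      × ((A : Subset m) → Agreeing m s A →
        (∣ A ∣ ≤ s) × (∣ A ∣ ≡ s → IsInterval m A)))
    × ((2 * s ≡ m) →
      ((A B : Subset m) → CrossAgreeing m s A B →
        (∣ A ∣ + ∣ B ∣ ≤ 2 * s)
        × ((∣ A ∣ + ∣ B ∣ ≡ 2 * s) ⇔ (∀ x → (x ∈ B) ⇔ (addMod m x s ∉ A))))
      × ((A : Subset m) → Agreeing m s A →
        (∣ A ∣ ≤ s)
        × (∣ A ∣ ≡ s → ∀ x → (x ∈ A) ⇔ (addMod m x s ∉ A))))
lemma3p5 m s 1≤s =
  (λ 2s<m → cross-case 2s<m , agreeing-case 2s<m) ,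
  (λ 2s≡m → half-case 2s≡m , half-agreeing 2s≡m)
  where open Regimes m s 1≤s
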